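{- Every labelled sequent derivable in the calculus $\mathsf{G3Xstit}$ is valid.
   Context: Fix a finite set of agents $Ag=\{1,\dots,n\}$ and a countable set $Var$ of propositional variables. $\mathcal L_{\mathsf{Xstit}}$ (negation normal form): $\phi ::= p\mid\overline p\mid\phi\wedge\phi\mid\phi\vee\phi\mid\Box\phi\mid\Diamond\phi\mid[A]^x\phi\mid\langle A\rangle^x\phi\mid[X]\phi\mid\langle X\rangle\phi$ with $p\in Var$, $A\subseteq Ag$. A relational $\mathsf{Xstit}$-model is $(W,\mathcal R_\Box,\mathcal R_X,\{\mathcal R_A\}_{A\subseteq Ag},V)$ with $W\ne\emptyset$, $V:Var\to\mathcal P(W)$ and: (D1) $\mathcal R_\Box$ is an equivalence relation; (D2) $\mathcal R_X$ is serial and deterministic; (D3) (i) $\mathcal R_\emptyset=\mathcal R_\Box\circ\mathcal R_X$; (ii) $\mathcal R_{Ag}=\mathcal R_X\circ\mathcal R_\Box$; (iii) $\mathcal R_A\subseteq\mathcal R_B$ whenever $B\subseteq A\subseteq Ag$; (iv) for all $A,B\subseteq Ag$ with $A\cap B=\emptyset$ and all $w_1,w_2,w_3,w_5,w_6$: if $\mathcal R_\Box w_1w_2$ and $\mathcal R_\Box w_1w_3$ then there is $w_4$ with $\mathcal R_\Box w_1w_4$, $(\mathcal R_Aw_4w_5\to\mathcal R_Aw_2w_5)$ and $(\mathcal R_Bw_4w_6\to\mathcal R_Bw_3w_6)$ (where $\mathcal R\circ\mathcal S=\{(w,u):\exists v(\mathcal Rwv\wedge\mathcal Svu)\}$). Satisfaction: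 $w\models p$ iff $w\in V(p)$; $w\models\overline p$ iff $w\notin V(p)$; $\wedge,\vee$ classical; $\Box/\Diamond$, $[A]^x/\langle A\rangle^x$, $[X]/\langle X\rangle$ are universal/existential quantification over $\mathcal R_\Box(w)$, $\mathcal R_A(w)$, $\mathcal R_X(w)$, with $\mathcal R(w)=\{v:(w,v)\in\mathcal R\}$. Labelled sequents of $\mathsf{G3Xstit}$: multisets of labelled formulas $x:\phi$ ($\phi\in\mathcal L_{\mathsf{Xstit}}$), relational atoms $\mathcal R_\Box xy$, $\mathcal R_Xxy$, $\mathcal R_Axy$ ($A\subseteq Ag$), and equalities $x=y$; labels from a countable set $L$. Rules ("$v$ fresh" means $v$ does not occur in the conclusion): (id) $\Gamma,w:p,w:\overline p$ is an axiom; ($\wedge$) from $\Gamma,w:\phi$ and $\Gamma,w:\psi$ infer $\Gamma,w:\phi\wedge\psi$; ($\vee$) from $\Gamma,w:\phi,w:\psi$ infer $\Gamma,w:\phi\vee\psi$; for each triple (box $\heartsuit$, diamond $\spadesuit$, relation $\mathcal R$) among ($\Box,\Diamond,\mathcal R_\Box$), ($[A]^x,\langle A\rangle^x,\mathcal R_A$), ($[X],\langle X\rangle,\mathcal R_X$): from $\Gamma,\mathcal Rwv,v:\phi$ infer $\Gamma,w:\heartsuit\phi$ ($v$ fresh) and from $\Gamma,\mathcal Rwu,w:\spadesuit\phi,u:\phi$ infer $\Gamma,\mathcal Rwu,w:\spadesuit\phi$; ($\mathsf{refl}_\Box$) from $\mathcal R_\Box ww,\Gamma$ infer $\Gamma$;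 ($\mathsf{refl}_=$) from $w=w,\Gamma$ infer $\Gamma$; ($\mathsf{eucl}_\Box$) from $\mathcal R_\Box wu,\mathcal R_\Box wv,\mathcal R_\Box uv,\Gamma$ infer $\mathcal R_\Box wu,\mathcal R_\Box wv,\Gamma$; ($\mathsf{eucl}_=$) from $w=u,w=v,u=v,\Gamma$ infer $w=u,w=v,\Gamma$; ($\mathsf{sub}_=$) from $w=u,\Delta[w],\Delta[u],\Gamma$ infer $w=u,\Delta[w],\Gamma$, where $\Delta[w]$ is a multiset of relational atoms and labelled formulas and $\Delta[u]$ replaces all occurrences of $w$ by $u$; ($\mathsf{Eff}\emptyset$) from $\mathcal R_\Box wv,\mathcal R_Xvu,\mathcal R_\emptyset wu,\Gamma$ infer $\mathcal R_\Box wv,\mathcal R_Xvu,\Gamma$; ($\emptyset\mathsf{Eff}$) from $\mathcal R_\Box wv,\mathcal R_Xvu,\mathcal R_\emptyset wu,\Gamma$ infer $\mathcal R_\emptyset wu,\Gamma$ ($v$ fresh); ($\mathsf{EffAg}$) from $\mathcal R_{Ag}wu,\mathcal R_Xwv,\mathcal R_\Box vu,\Gamma$ infer $\mathcal R_Xwv,\mathcal R_\Box vu,\Gamma$; ($\mathsf{AgEff}$) from $\mathcal R_{Ag}wu,\mathcal R_Xwv,\mathcal R_\Box vu,\Gamma$ infer $\mathcal R_{Ag}wu,\Gamma$ ($v$ fresh); ($\mathsf{C\text{ - }Mon}$) for $B\subseteq A\subseteq Ag$, from $\mathcal R_Awv,\mathcal R_Bwv,\Gamma$ infer $\mathcal R_Awv,\Gamma$;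 ($\mathsf{ser}_X$) from $\mathcal R_Xwv,\Gamma$ infer $\Gamma$ ($v$ fresh); ($\mathsf{det}_X$) from $v=u,\mathcal R_Xwv,\mathcal R_Xwu,\Gamma$ infer $\mathcal R_Xwv,\mathcal R_Xwu,\Gamma$; and the system of rules ($\mathsf{IOA}_X$) for disjoint $A,B\subseteq Ag$, consisting of ($\mathsf{IOA\text{ - }E}$) from $\mathcal R_\Box w_1w_2,\mathcal R_\Box w_1w_3,\mathcal R_\Box w_1w_4,\Gamma''$ infer $\mathcal R_\Box w_1w_2,\mathcal R_\Box w_1w_3,\Gamma''$ ($w_4$ fresh), ($\mathsf{IOA\text{ - }U_1}$) from $\mathcal R_Aw_4w_5,\mathcal R_Aw_2w_5,\Gamma$ infer $\mathcal R_Aw_4w_5,\Gamma$, and ($\mathsf{IOA\text{ - }U_2}$) from $\mathcal R_Bw_4w_6,\mathcal R_Bw_3w_6,\Gamma'$ infer $\mathcal R_Bw_4w_6,\Gamma'$; ($\mathsf{IOA\text{ - }E}$) may be used freely, but ($\mathsf{IOA\text{ - }U_1}$) and ($\mathsf{IOA\text{ - }U_2}$) may only be used together, in separate branches, both above an instance of ($\mathsf{IOA\text{ - }E}$) with the same $w_1,\dots,w_4$. The calculus also contains, for each rule where a substitution of labels duplicates active relational atoms or equalities, the instance with the duplicates contracted. Interpretation: for an $\mathsf{Xstit}$-model $M$ and $I:L\to W$ ($=$ interpreted as identity), $\Gamma$ is satisfied in $M$ under $I$ iff, whenever all relational atoms and equalities in $\Gamma$ hold of the images under $I$, some $z:\phi$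 in $\Gamma$ has $M,I(z)\models\phi$. $\Gamma$ is valid iff satisfied in every $\mathsf{Xstit}$-model under every $I$. -}

module Defs where

open import Data.Nat using (ℕ)
open import Data.Bool using (Bool; if_then_else_)
import Data.Bool.Properties as BoolP
import Data.Nat.Properties as ℕP
open import Data.Nat using (_≡ᵇ_)
open import Data.Fin.Subset using (Subset; _⊆_; _∩_; Empty)
import Data.Fin.Subset as Sub
import Data.Vec.Properties as VecP
open import Data.Product using (Σ; ∃; _×_; _,_)
open import Data.Sum using (_⊎_)
open import Data.Unit using (⊤)
open import Data.Empty renaming (⊥ to Zero)
open import Data.List using (List; []; _∷_; [_]; _++_; map; deduplicate)
open import Data.List.Relation.Unary.All using (All)
open import Data.List.Relation.Unary.Any using (Any)
open import Data.List.Membership.Propositional using (_∈_)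
open import Data.List.Relation.Binary.Permutation.Propositional using (_↭_)
open import Relation.Nullary using (¬_; Dec; yes; no)
open import Relation.Binary.Core using (_⇔_)
open import Relation.Binary.Definitions using (DecidableEquality)
open import Relation.Binary.Structures using (IsEquivalence)
open import Relation.Binary.PropositionalEquality using (_≡_; refl; cong; cong₂)

-- Agents Ag = Fin n ; coalitions A ⊆ Ag are  Subset n.
-- ∅ = Sub.⊥ and Ag = Sub.⊤.  Propositional variables and labels: ℕ.

Var : Set
Var = ℕ

Label : Set
Label = ℕ

infixr 6 _∧_
infixr 5 _∨_

data Fm (n : ℕ) : Set where
  var    : Var → Fm n
  nvar   : Var → Fm n
  _∧_    : Fm n → Fm n → Fm n
  _∨_    : Fm n → Fm n → Fm n
  □      : Fm n → Fm n
  ◇      : Fm n → Fm n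
  [_]ˣ   : Subset n → Fm n → Fm n
  ⟨_⟩ˣ   : Subset n → Fm n → Fm n
  [X]    : Fm n → Fm n
  ⟨X⟩    : Fm n → Fm n

_∘ᴿ_ : {W : Set} → (W → W → Set) → (W → W → Set) → W → W → Set
(R ∘ᴿ S) w u = ∃ λ v → R w v × S v u

record Model (n : ℕ) : Set₁ where
  field
    W    : Set
    w₀   : W                                   -- W ≠ ∅
    R□   : W → W → Set
    RX   : W → W → Set
    R    : Subset n → W → W → Set
    V    : Var → W → Set
    R□-equiv : IsEquivalence R□
    RX-serial        : ∀ w → ∃ λ v → RX w v
    RX-deterministic : ∀ {w v u} → RX w v → RX w u → v ≡ u
    R∅-def   : R Sub.⊥ ⇔ (R□ ∘ᴿ RX)
    RAg-def  : R Sub.⊤ ⇔ (RX ∘ᴿ R□)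
    R-mono   : ∀ {A B} → B ⊆ A → ∀ {w v} → R A w v → R B w v
    IOA      : ∀ {A B} → Empty (A ∩ B) → ∀ {w₁ w₂ w₃} → R□ w₁ w₂ → R□ w₁ w₃ →
               ∃ λ w₄ → R□ w₁ w₄
                      × (∀ w₅ → R A w₄ w₅ → R A w₂ w₅)
                      × (∀ w₆ → R B w₄ w₆ → R B w₃ w₆)

module _ {n : ℕ} (M : Model n) where
  open Model M

  infix 3 _⊨_
  _⊨_ : W → Fm n → Set
  w ⊨ var p     = V p w
  w ⊨ nvar p    = ¬ V p w
  w ⊨ φ ∧ ψ     = (w ⊨ φ) × (w ⊨ ψ)
  w ⊨ φ ∨ ψ     = (w ⊨ φ) ⊎ (w ⊨ ψ)
  w ⊨ □ φ       = ∀ v → R□ w v → v ⊨ φ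
  w ⊨ ◇ φ       = ∃ λ v → R□ w v × (v ⊨ φ)
  w ⊨ [ A ]ˣ φ  = ∀ v → R A w v → v ⊨ φ
  w ⊨ ⟨ A ⟩ˣ φ  = ∃ λ v → R A w v × (v ⊨ φ)
  w ⊨ [X] φ     = ∀ v → RX w v → v ⊨ φ
  w ⊨ ⟨X⟩ φ     = ∃ λ v → RX w v × (v ⊨ φ)

data Atom (n : ℕ) : Set where
  r□  : Label → Label → Atom n
  rX  : Label → Label → Atom n
  r   : Subset n → Label → Label → Atom n
  _≐_ : Label → Label → Atom n

infix 4 _∶_
data Elem (n : ℕ) : Set where
  _∶_ : Label → Fm n → Elem n
  at  : Atom n → Elem n

-- sequents are multisets, represented as lists (with an exchange rule below)
Sequent : ℕ → Set
Sequent n = List (Elem n)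

ats : ∀ {n} → List (Atom n) → Sequent n
ats = map at

_≟ᵃ_ : ∀ {n} → DecidableEquality (Atom n)
r□ x y ≟ᵃ r□ x' y' with x ℕP.≟ x' | y ℕP.≟ y'
... | yes refl | yes refl = yes refl
... | no p | _ = no λ { refl → p refl }
... | _ | no q = no λ { refl → q refl }
r□ _ _ ≟ᵃ rX _ _ = no λ ()
r□ _ _ ≟ᵃ r _ _ _ = no λ ()
r□ _ _ ≟ᵃ (_ ≐ _) = no λ ()
rX _ _ ≟ᵃ r□ _ _ = no λ ()
rX x y ≟ᵃ rX x' y' with x ℕP.≟ x' | y ℕP.≟ y'
... | yes refl | yes refl = yes refl
... | no p | _ = no λ { refl → p refl }
... | _ | no q = no λ { refl → q refl }
rX _ _ ≟ᵃ r _ _ _ = no λ ()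
rX _ _ ≟ᵃ (_ ≐ _) = no λ ()
r _ _ _ ≟ᵃ r□ _ _ = no λ ()
r _ _ _ ≟ᵃ rX _ _ = no λ ()
r A x y ≟ᵃ r A' x' y' with VecP.≡-dec BoolP._≟_ A A' | x ℕP.≟ x' | y ℕP.≟ y'
... | yes refl | yes refl | yes refl = yes refl
... | no p | _ | _ = no λ { refl → p refl }
... | _ | no p | _ = no λ { refl → p refl }
... | _ | _ | no q = no λ { refl → q refl }
r _ _ _ ≟ᵃ (_ ≐ _) = no λ ()
(_ ≐ _) ≟ᵃ r□ _ _ = no λ ()
(_ ≐ _) ≟ᵃ rX _ _ = no λ ()
(_ ≐ _) ≟ᵃ r _ _ _ = no λ ()
(x ≐ y) ≟ᵃ (x' ≐ y') with x ℕP.≟ x' | y ℕP.≟ y'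
... | yes refl | yes refl = yes refl
... | no p | _ = no λ { refl → p refl }
... | _ | no q = no λ { refl → q refl }

nub : ∀ {n} → List (Atom n) → List (Atom n)
nub = deduplicate _≟ᵃ_

Occ : ∀ {n} → Label → Elem n → Set
Occ v (x ∶ φ)        = v ≡ x
Occ v (at (r□ x y))  = v ≡ x ⊎ v ≡ y
Occ v (at (rX x y))  = v ≡ x ⊎ v ≡ y
Occ v (at (r A x y)) = v ≡ x ⊎ v ≡ y
Occ v (at (x ≐ y))   = v ≡ x ⊎ v ≡ y

Fresh : ∀ {n} → Label → Sequent n → Set
Fresh v Γ = All (λ e → ¬ Occ v e) Γ

relabel : Label → Label → Label → Label
relabel w u x = if x ≡ᵇ w then u else x

substE : ∀ {n} → Label → Label → Elem n → Elem n
substE w u (x ∶ φ)        = relabel w u x ∶ φ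
substE w u (at (r□ x y))  = at (r□ (relabel w u x) (relabel w u y))
substE w u (at (rX x y))  = at (rX (relabel w u x) (relabel w u y))
substE w u (at (r A x y)) = at (r A (relabel w u x) (relabel w u y))
substE w u (at (x ≐ y))   = at (relabel w u x ≐ relabel w u y)

NotEq : ∀ {n} → Elem n → Set
NotEq (at (_ ≐ _)) = Zero
NotEq _            = ⊤

record IOAInst (n : ℕ) : Set where
  constructor ioa
  field
    A B  : Subset n
    disj : Empty (A ∩ B)
    w₁ w₂ w₃ w₄ : Label

-- Relational rules (other than IOA-E), as:  RelRule E P Q F  where
--   P = active atoms of the conclusion, Q = atoms added in the premise,
--   F = labels required to be fresh (not occurring in the conclusion);
-- the rule is:   from  Q, P, Γ   infer   P, Γ.
-- E is the list of (IOA-E) instances below the current point, which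
-- licenses (IOA-U₁)/(IOA-U₂).
data RelRule {n : ℕ} (E : List (IOAInst n)) :
     List (Atom n) → List (Atom n) → List Label → Set where
  refl□ : ∀ w → RelRule E [] [ r□ w w ] []
  refl= : ∀ w → RelRule E [] [ w ≐ w ] []
  eucl□ : ∀ w u v → RelRule E (r□ w u ∷ r□ w v ∷ []) [ r□ u v ] []
  eucl= : ∀ w u v → RelRule E (w ≐ u ∷ w ≐ v ∷ []) [ u ≐ v ] []
  Eff∅  : ∀ w v u → RelRule E (r□ w v ∷ rX v u ∷ []) [ r Sub.⊥ w u ] []
  ∅Eff  : ∀ w v u → RelRule E [ r Sub.⊥ w u ] (r□ w v ∷ rX v u ∷ []) [ v ]
  EffAg : ∀ w v u → RelRule E (rX w v ∷ r□ v u ∷ []) [ r Sub.⊤ w u ] []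
  AgEff : ∀ w v u → RelRule E [ r Sub.⊤ w u ] (rX w v ∷ r□ v u ∷ []) [ v ]
  C-Mon : ∀ {A B} → B ⊆ A → ∀ w v → RelRule E [ r A w v ] [ r B w v ] []
  serX  : ∀ w v → RelRule E [] [ rX w v ] [ v ]
  detX  : ∀ w v u → RelRule E (rX w v ∷ rX w u ∷ []) [ v ≐ u ] []
  IOA-U₁ : ∀ {A B d w₁ w₂ w₃ w₄} → ioa A B d w₁ w₂ w₃ w₄ ∈ E →
           ∀ w₅ → RelRule E [ r A w₄ w₅ ] [ r A w₂ w₅ ] []
  IOA-U₂ : ∀ {A B d w₁ w₂ w₃ w₄} → ioa A B d w₁ w₂ w₃ w₄ ∈ E →
           ∀ w₆ → RelRule E [ r B w₄ w₆ ] [ r B w₃ w₆ ] []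

AllFresh : ∀ {n} → List Label → Sequent n → Set
AllFresh F Γ = All (λ v → Fresh v Γ) F

-- Derivations; Der E Γ : Γ derivable above the (IOA-E) instances in E
data Der {n : ℕ} (E : List (IOAInst n)) : Sequent n → Set where
  perm  : ∀ {Γ Δ} → Γ ↭ Δ → Der E Γ → Der E Δ
  id    : ∀ {Γ} w p → Der E ((w ∶ var p) ∷ (w ∶ nvar p) ∷ Γ)
  ∧-R   : ∀ {Γ w φ ψ} → Der E ((w ∶ φ) ∷ Γ) → Der E ((w ∶ ψ) ∷ Γ) →
          Der E ((w ∶ φ ∧ ψ) ∷ Γ)
  ∨-R   : ∀ {Γ w φ ψ} → Der E ((w ∶ φ) ∷ (w ∶ ψ) ∷ Γ) → Der E ((w ∶ φ ∨ ψ) ∷ Γ)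
  □-R   : ∀ {Γ w φ} v → Fresh v ((w ∶ □ φ) ∷ Γ) →
          Der E (at (r□ w v) ∷ (v ∶ φ) ∷ Γ) → Der E ((w ∶ □ φ) ∷ Γ)
  ◇-R   : ∀ {Γ w u φ} → Der E (at (r□ w u) ∷ (w ∶ ◇ φ) ∷ (u ∶ φ) ∷ Γ) →
          Der E (at (r□ w u) ∷ (w ∶ ◇ φ) ∷ Γ)
  [A]-R : ∀ {Γ w A φ} v → Fresh v ((w ∶ [ A ]ˣ φ) ∷ Γ) →
          Der E (at (r A w v) ∷ (v ∶ φ) ∷ Γ) → Der E ((w ∶ [ A ]ˣ φ) ∷ Γ)
  ⟨A⟩-R : ∀ {Γ w u A φ} → Der E (at (r A w u) ∷ (w ∶ ⟨ A ⟩ˣ φ) ∷ (u ∶ φ) ∷ Γ) →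
          Der E (at (r A w u) ∷ (w ∶ ⟨ A ⟩ˣ φ) ∷ Γ)
  [X]-R : ∀ {Γ w φ} v → Fresh v ((w ∶ [X] φ) ∷ Γ) →
          Der E (at (rX w v) ∷ (v ∶ φ) ∷ Γ) → Der E ((w ∶ [X] φ) ∷ Γ)
  ⟨X⟩-R : ∀ {Γ w u φ} → Der E (at (rX w u) ∷ (w ∶ ⟨X⟩ φ) ∷ (u ∶ φ) ∷ Γ) →
          Der E (at (rX w u) ∷ (w ∶ ⟨X⟩ φ) ∷ Γ)
  sub=  : ∀ {Γ} w u (Δ : Sequent n) → All NotEq Δ →
          Der E (at (w ≐ u) ∷ Δ ++ map (substE w u) Δ ++ Γ) →
          Der E (at (w ≐ u) ∷ Δ ++ Γ)
  rel   : ∀ {Γ P Q F} → RelRule E P Q F → AllFresh F (ats P ++ Γ) →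
          Der E (ats Q ++ ats P ++ Γ) → Der E (ats P ++ Γ)
  -- their contracted instances (duplicated active atoms identified)
  relC  : ∀ {Γ P Q F} → RelRule E P Q F → AllFresh F (ats (nub P) ++ Γ) →
          Der E (ats (nub (P ++ Q)) ++ Γ) → Der E (ats (nub P) ++ Γ)
  IOA-E  : ∀ {Γ A B} (d : Empty (A ∩ B)) w₁ w₂ w₃ w₄ →
           Fresh w₄ (ats (r□ w₁ w₂ ∷ r□ w₁ w₃ ∷ []) ++ Γ) →
           Der (ioa A B d w₁ w₂ w₃ w₄ ∷ E)
               (ats (r□ w₁ w₄ ∷ r□ w₁ w₂ ∷ r□ w₁ w₃ ∷ []) ++ Γ) →
           Der E (ats (r□ w₁ w₂ ∷ r□ w₁ w₃ ∷ []) ++ Γ)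
  IOA-EC : ∀ {Γ A B} (d : Empty (A ∩ B)) w₁ w₂ w₃ w₄ →
           Fresh w₄ (ats (nub (r□ w₁ w₂ ∷ r□ w₁ w₃ ∷ [])) ++ Γ) →
           Der (ioa A B d w₁ w₂ w₃ w₄ ∷ E)
               (ats (nub (r□ w₁ w₂ ∷ r□ w₁ w₃ ∷ r□ w₁ w₄ ∷ [])) ++ Γ) →
           Der E (ats (nub (r□ w₁ w₂ ∷ r□ w₁ w₃ ∷ [])) ++ Γ)

Derivable : ∀ {n} → Sequent n → Set
Derivable Γ = Der [] Γ

module _ {n : ℕ} (M : Model n) (I : Label → Model.W M) where
  open Model M

  AtomHolds : Atom n → Set
  AtomHolds (r□ x y)  = R□ (I x) (I y)
  AtomHolds (rX x y)  = RX (I x) (I y)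
  AtomHolds (r A x y) = R A (I x) (I y)
  AtomHolds (x ≐ y)   = I x ≡ I y

  Hyp : Elem n → Set
  Hyp (x ∶ φ) = ⊤
  Hyp (at a)  = AtomHolds a

  Concl : Elem n → Set
  Concl (x ∶ φ) = _⊨_ M (I x) φ
  Concl (at a)  = Zero

  SatisfiedUnder : Sequent n → Set
  SatisfiedUnder Γ = All Hyp Γ → Any Concl Γ

Valid : ∀ {n} → Sequent n → Set₁
Valid {n} Γ = ∀ (M : Model n) (I : Label → Model.W M) → SatisfiedUnder M I Γ

module Submission where

-- The proof is an induction on derivations, strengthened in two ways.
-- (1) The rules (IOA-U₁), (IOA-U₂) are sound only for interpretations that send the
--     fresh label w₄ of the (IOA-E) instance below them to an IOA-witness of w₂ and
--     w₃.  So for every list E of (IOA-E) instances we show that a sequent derived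
--     above E is satisfied by every E-good interpretation, provided the boxed atoms
--     of each instance occur in it ("E is anchored"); anchoring keeps the labels of
--     E distinct from the fresh labels of later rules.
-- (2) A rule with a fresh label v is sound because v can be reassigned without
--     affecting its conclusion.  The exception is (serX) with w = v, whose premise
--     demands a reflexive X-step: there the model is extended by one new point
--     related only to itself, which leaves truth at the old points unchanged.  The theorem is the induction that combines
-- them; excluded middle is used for the axioms and the box rules.

open import Defs
open import Level using (0ℓ)
open import Axiom.ExcludedMiddle using (ExcludedMiddle)

open import Function using (_∘_)
open import Data.Nat using (ℕ; _≡ᵇ_)
import Data.Nat.Properties as ℕ
open import Data.Bool using (true; false; T)
open import Data.Maybe using (Maybe; just; nothing)
open import Data.Fin.Subset using (Subset; Empty; _∩_)
open import Data.Product using (∃; _×_; _,_; proj₁; proj₂)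
open import Data.Sum using (inj₁; inj₂)
open import Data.Unit using (tt)
open import Data.Empty using (⊥; ⊥-elim)
open import Data.List using (List; []; _∷_; [_]; _++_; map)
import Data.List.Properties as List
open import Data.List.Relation.Unary.All as All using (All; []; _∷_)
import Data.List.Relation.Unary.All.Properties as AllP
open import Data.List.Relation.Unary.Any as Any using (Any; here; there)
import Data.List.Relation.Unary.Any.Properties as AnyP
open import Data.List.Membership.Propositional using (_∈_; find; lose)
open import Data.List.Membership.Propositional.Properties
  using (∈-map⁺; ∈-++⁺ˡ; ∈-++⁺ʳ; ∈-++⁻; ∈-deduplicate⁺; ∈-deduplicate⁻)
open import Data.List.Relation.Binary.Subset.Propositional using (_⊆_)
import Data.List.Relation.Binary.Subset.Propositional.Properties as ⊆
open import Data.List.Relation.Binary.Permutation.Propositional using (_↭_; ↭-sym)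
open import Data.List.Relation.Binary.Permutation.Propositional.Properties
  using (All-resp-↭; Any-resp-↭; ∈-resp-↭)
open import Relation.Nullary using (¬_; yes; no)
open import Relation.Binary.Core using (_⇔_)
open import Relation.Binary.Structures using (IsEquivalence)
open import Relation.Binary.PropositionalEquality
  using (_≡_; _≢_; refl; sym; trans; cong; subst; subst₂)

_[_↦_] : {W : Set} → (Label → W) → Label → W → Label → W
(I [ v ↦ d ]) x with v ℕ.≟ x
... | yes _ = d
... | no  _ = I x

↦-same : ∀ {W : Set} (I : Label → W) v d → (I [ v ↦ d ]) v ≡ d
↦-same I v d with v ℕ.≟ v
... | yes _   = refl
... | no v≢v = ⊥-elim (v≢v refl)

↦-other : ∀ {W : Set} (I : Label → W) {v} d {x} → v ≢ x → (I [ v ↦ d ]) x ≡ I x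
↦-other I {v} d {x} v≢x with v ℕ.≟ x
... | yes v≡x = ⊥-elim (v≢x v≡x)
... | no  _   = refl

↦-target : ∀ {W : Set} (Rel : W → W → Set) (I : Label → W) {v d x} → v ≢ x →
           Rel (I x) d → Rel ((I [ v ↦ d ]) x) ((I [ v ↦ d ]) v)
↦-target Rel I {v} {d} v≢x ρ = subst₂ Rel (sym (↦-other I d v≢x)) (sym (↦-same I v d)) ρ

↦-source : ∀ {W : Set} (Rel : W → W → Set) (I : Label → W) {v d x} → v ≢ x →
           Rel d (I x) → Rel ((I [ v ↦ d ]) v) ((I [ v ↦ d ]) x)
↦-source Rel I {v} {d} v≢x ρ = subst₂ Rel (sym (↦-same I v d)) (sym (↦-other I d v≢x)) ρ

fresh-apart : ∀ {n} {v x} {e : Elem n} {Γ : Sequent n} → Fresh v Γ → e ∈ Γ → Occ x e → v ≢ x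
fresh-apart {e = e} fr e∈Γ occ v≡x = All.lookup fr e∈Γ (subst (λ y → Occ y e) (sym v≡x) occ)

-- Satisfaction is carried from (M , I) to (M' , J) along Γ when the hypotheses
-- of Γ are preserved and its conclusions reflected.  Every rule with fresh labels
-- is justified by such a transfer.
record Transfer {n} (M : Model n) (I : Label → Model.W M)
                (M' : Model n) (J : Label → Model.W M') (Γ : Sequent n) : Set where
  field
    hyps  : All (Hyp M I) Γ → All (Hyp M' J) Γ
    concl : Any (Concl M' J) Γ → Any (Concl M I) Γ
open Transfer

transfer-id : ∀ {n} {M : Model n} {I Γ} → Transfer M I M I Γ
transfer-id = record { hyps = λ hs → hs ; concl = λ c → c }

_⨾_ : ∀ {n} {M M' M'' : Model n} {I J K Γ} →
      Transfer M I M' J Γ → Transfer M' J M'' K Γ → Transfer M I M'' K Γ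
s ⨾ t = record { hyps = hyps t ∘ hyps s ; concl = concl s ∘ concl t }

module _ {n : ℕ} (M : Model n) where
  open Model M

  AgreeOn : (Label → W) → (Label → W) → Elem n → Set
  AgreeOn I J e = ∀ x → Occ x e → I x ≡ J x

  agree-hyp : ∀ {I J} e → AgreeOn I J e → Hyp M I e → Hyp M J e
  agree-hyp (x ∶ φ)        ag h = tt
  agree-hyp (at (r□ x y))  ag h = subst₂ R□ (ag x (inj₁ refl)) (ag y (inj₂ refl)) h
  agree-hyp (at (rX x y))  ag h = subst₂ RX (ag x (inj₁ refl)) (ag y (inj₂ refl)) h
  agree-hyp (at (r A x y)) ag h = subst₂ (R A) (ag x (inj₁ refl)) (ag y (inj₂ refl)) h
  agree-hyp (at (x ≐ y))   ag h = trans (sym (ag x (inj₁ refl))) (trans h (ag y (inj₂ refl)))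

  agree-concl : ∀ {I J} e → AgreeOn I J e → Concl M J e → Concl M I e
  agree-concl (x ∶ φ) ag c = subst (λ a → _⊨_ M a φ) (sym (ag x refl)) c

  agree-transfer : ∀ {I J Γ} → All (AgreeOn I J) Γ → Transfer M I M J Γ
  agree-transfer ag = record
    { hyps  = λ hs → All.tabulate λ e∈Γ → agree-hyp _ (All.lookup ag e∈Γ) (All.lookup hs e∈Γ)
    ; concl = λ c → let e , e∈Γ , ce = find c in lose e∈Γ (agree-concl e (All.lookup ag e∈Γ) ce) }

  transfer-fresh : ∀ {I v d Γ} → Fresh v Γ → Transfer M I M (I [ v ↦ d ]) Γ
  transfer-fresh {I} {v} {d} fr = agree-transfer (All.map unaffected fr)
    where
    unaffected : ∀ {e} → ¬ Occ v e → AgreeOn I (I [ v ↦ d ]) e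
    unaffected {e} v∉e x occ = sym (↦-other I d λ v≡x → v∉e (subst (λ y → Occ y e) (sym v≡x) occ))

-- Condition (D3)(iv) provides such witnesses.
IOAWitness : ∀ {n} {W : Set} → (Subset n → W → W → Set) → Subset n → Subset n → W → W → W → Set
IOAWitness R A B b c a = (∀ x → R A a x → R A b x) × (∀ x → R B a x → R B c x)

witness-resp : ∀ {n} {W : Set} {R : Subset n → W → W → Set} {A B b b' c c' a a'} →
               b ≡ b' → c ≡ c' → a ≡ a' → IOAWitness R A B b c a → IOAWitness R A B b' c' a'
witness-resp refl refl refl wit = wit

-- I is good for an (IOA-E) instance when it sends w₄ to an IOA-witness of w₂ and w₃;
-- the rules (IOA-U₁), (IOA-U₂) are sound exactly for such interpretations.
GoodFor : ∀ {n} (M : Model n) → (Label → Model.W M) → IOAInst n → Set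
GoodFor M I (ioa A B _ _ w₂ w₃ w₄) = IOAWitness (Model.R M) A B (I w₂) (I w₃) (I w₄)

Good : ∀ {n} (M : Model n) → (Label → Model.W M) → List (IOAInst n) → Set
Good M I E = All (GoodFor M I) E

AnchoredIn : ∀ {n} → Sequent n → IOAInst n → Set
AnchoredIn Γ (ioa _ _ _ w₁ w₂ w₃ w₄) =
  at (r□ w₁ w₂) ∈ Γ × at (r□ w₁ w₃) ∈ Γ × at (r□ w₁ w₄) ∈ Γ

Anchored : ∀ {n} → List (IOAInst n) → Sequent n → Set
Anchored E Γ = All (AnchoredIn Γ) E

-- Premises keep the atoms of their conclusion, hence stay anchored.
anchored-mono : ∀ {n} {E : List (IOAInst n)} {Γ Δ : Sequent n} →
                (∀ {a} → at a ∈ Γ → at a ∈ Δ) → Anchored E Γ → Anchored E Δ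
anchored-mono Γ⊑Δ = All.map λ { {ioa _ _ _ _ _ _ _} (m₂ , m₃ , m₄) → Γ⊑Δ m₂ , Γ⊑Δ m₃ , Γ⊑Δ m₄ }

formula-free : ∀ {n} {x φ} {Γ : Sequent n} {a} → at a ∈ (x ∶ φ) ∷ Γ → at a ∈ Γ
formula-free (there a∈Γ) = a∈Γ

good-fresh : ∀ {n} (M : Model n) {I v d} {E : List (IOAInst n)} {Γ} →
             Fresh v Γ → Anchored E Γ → Good M I E → Good M (I [ v ↦ d ]) E
good-fresh M {I} {v} {d} {Γ = Γ} fr = kept
  where
  unmoved : ∀ {w x} → at (r□ w x) ∈ Γ → I x ≡ (I [ v ↦ d ]) x
  unmoved m = sym (↦-other I d (fresh-apart fr m (inj₂ refl)))
  kept : ∀ {E} → Anchored E Γ → Good M I E → Good M (I [ v ↦ d ]) E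
  kept [] [] = []
  kept {ioa _ _ _ _ _ _ _ ∷ _} ((m₂ , m₃ , m₄) ∷ anch) (wit ∷ g) =
    witness-resp {R = Model.R M} (unmoved m₂) (unmoved m₃) (unmoved m₄) wit ∷ kept anch g

-- The extension of a model by one new point (nothing) that every relation links to
-- itself and to nothing else.
module Extended {n : ℕ} (M : Model n) where
  open Model M

  data Lift (R₀ : W → W → Set) : Maybe W → Maybe W → Set where
    old : ∀ {a b} → R₀ a b → Lift R₀ (just a) (just b)
    new : Lift R₀ nothing nothing

  lift-map : ∀ {R₀ S₀ : W → W → Set} → (∀ {a b} → R₀ a b → S₀ a b) →
             ∀ {x y} → Lift R₀ x y → Lift S₀ x y
  lift-map f (old ρ) = old (f ρ)
  lift-map f new     = new

  lift-equivalence : ∀ {R₀ : W → W → Set} → IsEquivalence R₀ → IsEquivalence (Lift R₀)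
  lift-equivalence {R₀} eq = record { refl = λ {x} → reflexive x ; sym = symmetric ; trans = transitive }
    where
    module E = IsEquivalence eq
    reflexive : ∀ x → Lift R₀ x x
    reflexive (just a) = old E.refl
    reflexive nothing  = new
    symmetric : ∀ {x y} → Lift R₀ x y → Lift R₀ y x
    symmetric (old ρ) = old (E.sym ρ)
    symmetric new     = new
    transitive : ∀ {x y z} → Lift R₀ x y → Lift R₀ y z → Lift R₀ x z
    transitive (old ρ) (old s) = old (E.trans ρ s)
    transitive new     new     = new

  lift-∘ : ∀ {R₀ S₀ T₀ : W → W → Set} → R₀ ⇔ (S₀ ∘ᴿ T₀) → Lift R₀ ⇔ (Lift S₀ ∘ᴿ Lift T₀)
  lift-∘ {R₀} {S₀} {T₀} (split , join) = split' , join'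
    where
    split' : ∀ {x y} → Lift R₀ x y → (Lift S₀ ∘ᴿ Lift T₀) x y
    split' (old ρ) = let b , s , t = split ρ in just b , old s , old t
    split' new     = nothing , new , new
    join' : ∀ {x y} → (Lift S₀ ∘ᴿ Lift T₀) x y → Lift R₀ x y
    join' (_ , old s , old t) = old (join (_ , s , t))
    join' (_ , new , new)     = new

  lift-serial : ∀ x → ∃ λ y → Lift RX x y
  lift-serial (just a) = let b , ab = RX-serial a in just b , old ab
  lift-serial nothing  = nothing , new

  lift-deterministic : ∀ {x y z} → Lift RX x y → Lift RX x z → y ≡ z
  lift-deterministic (old ρ) (old s) = cong just (RX-deterministic ρ s)
  lift-deterministic new     new     = refl

  embed-witness : ∀ {A B a b c} → IOAWitness R A B b c a →
                  IOAWitness (λ A → Lift (R A)) A B (just b) (just c) (just a)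
  embed-witness (toB , toC) = (λ { _ (old ρ) → old (toB _ ρ) }) , (λ { _ (old ρ) → old (toC _ ρ) })

  lift-ioa : ∀ {A B} → Empty (A ∩ B) → ∀ {x y z} → Lift R□ x y → Lift R□ x z →
             ∃ λ t → Lift R□ x t × IOAWitness (λ A → Lift (R A)) A B y z t
  lift-ioa disj (old ρ) (old s) = let a , ra , wit = IOA disj ρ s in just a , old ra , embed-witness wit
  lift-ioa disj new     new     = nothing , new , (λ _ l → l) , (λ _ l → l)

  lift-V : Var → Maybe W → Set
  lift-V p (just a) = V p a
  lift-V p nothing  = ⊥

  extended : Model n
  extended = record
    { W = Maybe W ; w₀ = just w₀
    ; R□ = Lift R□ ; RX = Lift RX ; R = λ A → Lift (R A) ; V = lift-V
    ; R□-equiv = lift-equivalence R□-equiv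
    ; RX-serial = lift-serial ; RX-deterministic = lift-deterministic
    ; R∅-def = lift-∘ R∅-def ; RAg-def = lift-∘ RAg-def
    ; R-mono = λ B⊆A → lift-map (R-mono B⊆A)
    ; IOA = lift-ioa
    }

  reflect : ∀ φ {a} → _⊨_ extended (just a) φ → _⊨_ M a φ
  reflect (var p)      t             = t
  reflect (nvar p)     t             = t
  reflect (φ ∧ ψ)      (t , u)       = reflect φ t , reflect ψ u
  reflect (φ ∨ ψ)      (inj₁ t)      = inj₁ (reflect φ t)
  reflect (φ ∨ ψ)      (inj₂ u)      = inj₂ (reflect ψ u)
  reflect (□ φ)        t             = λ b ρ → reflect φ (t (just b) (old ρ))
  reflect (◇ φ)        (_ , old ρ , t) = _ , ρ , reflect φ t
  reflect ([ A ]ˣ φ)   t             = λ b ρ → reflect φ (t (just b) (old ρ))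
  reflect (⟨ A ⟩ˣ φ)   (_ , old ρ , t) = _ , ρ , reflect φ t
  reflect ([X] φ)      t             = λ b ρ → reflect φ (t (just b) (old ρ))
  reflect (⟨X⟩ φ)      (_ , old ρ , t) = _ , ρ , reflect φ t

  embed-hyp : ∀ {I} e → Hyp M I e → Hyp extended (just ∘ I) e
  embed-hyp (x ∶ φ)        h = tt
  embed-hyp (at (r□ x y))  h = old h
  embed-hyp (at (rX x y))  h = old h
  embed-hyp (at (r A x y)) h = old h
  embed-hyp (at (x ≐ y))   h = cong just h

  embed-concl : ∀ {I} e → Concl extended (just ∘ I) e → Concl M I e
  embed-concl (x ∶ φ) c = reflect φ c

  transfer-embed : ∀ {I Γ} → Transfer M I extended (just ∘ I) Γ
  transfer-embed = record { hyps = All.map (λ {e} → embed-hyp e) ; concl = Any.map (λ {e} → embed-concl e) }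

  good-embed : ∀ {I E} → Good M I E → Good extended (just ∘ I) E
  good-embed = All.map λ { {ioa A B _ _ _ _ _} → embed-witness {A} {B} }

-- Soundness relative to E: if E is anchored in Γ, every E-good interpretation
-- into any Xstit-model satisfies Γ.  For E = [] this is validity.
Sound : ∀ {n} → List (IOAInst n) → Sequent n → Set₁
Sound {n} E Γ = Anchored E Γ → (M : Model n) (I : Label → Model.W M) → Good M I E →
                SatisfiedUnder M I Γ

record Reduction {n} (E' : List (IOAInst n)) (M : Model n) (I : Label → Model.W M)
                 (Γ Π : Sequent n) : Set₁ where
  constructor reduction
  field
    model  : Model n
    interp : Label → Model.W model
    good   : Good model interp E'
    hyps   : All (Hyp model interp) Π
    back   : Any (Concl model interp) Π → Any (Concl M I) Γ

Reduces : ∀ {n} → List (IOAInst n) → Sequent n → List (IOAInst n) → Sequent n → Set₁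
Reduces {n} E Γ E' Π = Anchored E Γ → Anchored E' Π ×
  ((M : Model n) (I : Label → Model.W M) → Good M I E → All (Hyp M I) Γ → Reduction E' M I Γ Π)

reduce : ∀ {n} {E E' : List (IOAInst n)} {Γ Π} → Reduces E Γ E' Π → Sound E' Π → Sound E Γ
reduce step premise anch M I g hs =
  let anch' , reduce-at = step anch
      reduction M' J g' hs' back = reduce-at M I g hs
  in back (premise anch' M' J g' hs')

reduces-resp : ∀ {n} {E E' : List (IOAInst n)} {Γ Π Π'} →
               Π ⊆ Π' → Π' ⊆ Π → Reduces E Γ E' Π' → Reduces E Γ E' Π
reduces-resp Π⊆Π' Π'⊆Π step anch =
  let anch' , reduce-at = step anch
  in anchored-mono Π'⊆Π anch' , λ M I g hs →
       let reduction M' J g' hs' back = reduce-at M I g hs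
       in reduction M' J g' (⊆.All-resp-⊇ Π⊆Π' hs') (back ∘ ⊆.Any-resp-⊆ Π⊆Π')

atoms-inert : ∀ {n} {M : Model n} {I} {Q : List (Atom n)} → ¬ Any (Concl M I) (ats Q)
atoms-inert c = proj₂ (Any.satisfied (AnyP.map⁻ c))

added : ∀ {n} {E : List (IOAInst n)} {M M' : Model n} {I J Γ} {Q : List (Atom n)} →
        Good M' J E → Transfer M I M' J Γ → All (AtomHolds M' J) Q → All (Hyp M I) Γ →
        Reduction E M I Γ (ats Q ++ Γ)
added {M = M} {M'} {I} {J} {Γ} {Q} g t q hs =
  reduction M' J g (AllP.++⁺ (AllP.map⁺ q) (hyps t hs)) back
  where
  back : Any (Concl M' J) (ats Q ++ Γ) → Any (Concl M I) Γ
  back c with AnyP.++⁻ (ats Q) c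
  ... | inj₁ cQ = ⊥-elim (atoms-inert cQ)
  ... | inj₂ cΓ = concl t cΓ

-- Contracted instances.  Deleting duplicate atoms changes no element, so
-- nub (P ++ Q) and Q ++ nub P have the same elements and hence are
-- interchangeable premises.
⊆-nub : ∀ {n} {L : List (Atom n)} → L ⊆ nub L
⊆-nub = ∈-deduplicate⁺ _≟ᵃ_

nub-⊆ : ∀ {n} (L : List (Atom n)) → nub L ⊆ L
nub-⊆ = ∈-deduplicate⁻ _≟ᵃ_

atom-in : ∀ {n} {L L' : List (Atom n)} {Γ : Sequent n} → L ⊆ L' → ∀ {a} → a ∈ L → at a ∈ ats L' ++ Γ
atom-in L⊆L' a∈L = ∈-++⁺ˡ (∈-map⁺ at (L⊆L' a∈L))

ats-⊆ : ∀ {n} {L L' : List (Atom n)} (Γ : Sequent n) → L ⊆ L' → ats L ++ Γ ⊆ ats L' ++ Γ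
ats-⊆ Γ L⊆L' = ⊆.++⁺ˡ Γ (⊆.map⁺ at L⊆L')

ats-++ : ∀ {n} (L L' : List (Atom n)) (Γ : Sequent n) → ats (L ++ L') ++ Γ ≡ ats L ++ ats L' ++ Γ
ats-++ L L' Γ = trans (cong (_++ Γ) (List.map-++ at L L')) (List.++-assoc (ats L) (ats L') Γ)

contracted : ∀ {n} {E E' : List (IOAInst n)} (P Q : List (Atom n)) {Γ : Sequent n} →
             Reduces E (ats (nub P) ++ Γ) E' (ats Q ++ ats (nub P) ++ Γ) →
             Reduces E (ats (nub P) ++ Γ) E' (ats (nub (P ++ Q)) ++ Γ)
contracted P Q {Γ} = reduces-resp
  (⊆.⊆-trans (ats-⊆ Γ shrink) (⊆.⊆-reflexive (ats-++ Q (nub P) Γ)))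
  (⊆.⊆-trans (⊆.⊆-reflexive (sym (ats-++ Q (nub P) Γ))) (ats-⊆ Γ grow))
  where
  shrink : nub (P ++ Q) ⊆ Q ++ nub P
  shrink a∈ with ∈-++⁻ P (nub-⊆ (P ++ Q) a∈)
  ... | inj₁ a∈P = ∈-++⁺ʳ Q (⊆-nub a∈P)
  ... | inj₂ a∈Q = ∈-++⁺ˡ a∈Q
  grow : Q ++ nub P ⊆ nub (P ++ Q)
  grow a∈ with ∈-++⁻ Q a∈
  ... | inj₁ a∈Q = ⊆-nub (∈-++⁺ʳ P a∈Q)
  ... | inj₂ a∈P = ⊆-nub (∈-++⁺ˡ (nub-⊆ P a∈P))

module RuleSemantics {n : ℕ} (M : Model n) where
  open Model M
  module R□ = IsEquivalence R□-equiv

  unchanged : ∀ {E : List (IOAInst n)} {I Γ a} → Good M I E → All (Hyp M I) Γ →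
              AtomHolds M I a → Reduction E M I Γ (at a ∷ Γ)
  unchanged g hs h = added g transfer-id (h ∷ []) hs

  reassigned : ∀ {E : List (IOAInst n)} {I v Γ Q} → Fresh v Γ → Anchored E Γ → Good M I E →
               All (Hyp M I) Γ → ∀ d → All (AtomHolds M (I [ v ↦ d ])) Q → Reduction E M I Γ (ats Q ++ Γ)
  reassigned fr anch g hs d q = added (good-fresh M fr anch g) (transfer-fresh M fr) q hs

  -- A relational rule adds to its conclusion only atoms that are made true either
  -- by the model conditions (D1)–(D3), or by sending its fresh label to a suitable
  -- point; (serX) with w = v needs the reflexive point of the extended model.
  rule-semantics : ∀ {E : List (IOAInst n)} {P Q F Γ} → RelRule E P Q F →
                   All (λ a → at a ∈ Γ) P → AllFresh F Γ → Anchored E Γ →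
                   ∀ I → Good M I E → All (Hyp M I) Γ → Reduction E M I Γ (ats Q ++ Γ)
  rule-semantics (refl□ _) [] _ _ I g hs = unchanged g hs R□.refl
  rule-semantics (refl= _) [] _ _ I g hs = unchanged g hs refl
  rule-semantics (eucl□ _ _ _) (wu ∷ wv ∷ []) _ _ I g hs =
    unchanged g hs (R□.trans (R□.sym (All.lookup hs wu)) (All.lookup hs wv))
  rule-semantics (eucl= _ _ _) (wu ∷ wv ∷ []) _ _ I g hs =
    unchanged g hs (trans (sym (All.lookup hs wu)) (All.lookup hs wv))
  rule-semantics (Eff∅ _ v _) (wv ∷ vu ∷ []) _ _ I g hs =
    unchanged g hs (proj₂ R∅-def (I v , All.lookup hs wv , All.lookup hs vu))
  rule-semantics (∅Eff _ _ _) (wu ∷ []) (v-fresh ∷ []) anch I g hs =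
    let d , wd , du = proj₁ R∅-def (All.lookup hs wu) in
    reassigned v-fresh anch g hs d
      (↦-target R□ I (fresh-apart v-fresh wu (inj₁ refl)) wd ∷
       ↦-source RX I (fresh-apart v-fresh wu (inj₂ refl)) du ∷ [])
  rule-semantics (EffAg _ v _) (wv ∷ vu ∷ []) _ _ I g hs =
    unchanged g hs (proj₂ RAg-def (I v , All.lookup hs wv , All.lookup hs vu))
  rule-semantics (AgEff _ _ _) (wu ∷ []) (v-fresh ∷ []) anch I g hs =
    let d , wd , du = proj₁ RAg-def (All.lookup hs wu) in
    reassigned v-fresh anch g hs d
      (↦-target RX I (fresh-apart v-fresh wu (inj₁ refl)) wd ∷
       ↦-source R□ I (fresh-apart v-fresh wu (inj₂ refl)) du ∷ [])
  rule-semantics (C-Mon B⊆A _ _) (wv ∷ []) _ _ I g hs = unchanged g hs (R-mono B⊆A (All.lookup hs wv))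
  rule-semantics (serX w v) [] (v-fresh ∷ []) anch I g hs with v ℕ.≟ w
  ... | no v≢w =
    let d , wd = RX-serial (I w) in
    reassigned v-fresh anch g hs d (↦-target RX I v≢w wd ∷ [])
  ... | yes refl =
    added (good-fresh extended v-fresh anch (good-embed g)) (transfer-embed ⨾ transfer-fresh extended v-fresh)
      (subst (λ a → Lift RX a a) (sym (↦-same (just ∘ I) v nothing)) new ∷ []) hs
    where open Extended M
  rule-semantics (detX _ _ _) (wv ∷ wu ∷ []) _ _ I g hs =
    unchanged g hs (RX-deterministic (All.lookup hs wv) (All.lookup hs wu))
  rule-semantics (IOA-U₁ inst w₅) (w₄w₅ ∷ []) _ _ I g hs =
    unchanged g hs (proj₁ (All.lookup g inst) (I w₅) (All.lookup hs w₄w₅))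
  rule-semantics (IOA-U₂ inst w₆) (w₄w₆ ∷ []) _ _ I g hs =
    unchanged g hs (proj₂ (All.lookup g inst) (I w₆) (All.lookup hs w₄w₆))

  -- (IOA-E): by (D3)(iv) the fresh label w₄ can be sent to an IOA-witness of w₂ and
  -- w₃ that is R□-accessible from w₁, which makes the interpretation good for the
  -- new instance.
  ioa-semantics : ∀ {E : List (IOAInst n)} {Γ A B} (disj : Empty (A ∩ B)) {w₁ w₂ w₃ w₄} →
                  Fresh w₄ Γ → at (r□ w₁ w₂) ∈ Γ → at (r□ w₁ w₃) ∈ Γ → Anchored E Γ →
                  ∀ I → Good M I E → All (Hyp M I) Γ →
                  Reduction (ioa A B disj w₁ w₂ w₃ w₄ ∷ E) M I Γ (at (r□ w₁ w₄) ∷ Γ)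
  ioa-semantics {Γ = Γ} {A} {B} disj {_} {w₂} {w₃} {w₄} fr m₂ m₃ anch I g hs =
    let a , w₁a , wit = IOA disj (All.lookup hs m₂) (All.lookup hs m₃)
        unmoved : ∀ {w x} → at (r□ w x) ∈ Γ → I x ≡ (I [ w₄ ↦ a ]) x
        unmoved m = sym (↦-other I a (fresh-apart fr m (inj₂ refl)))
        witness-for-new : IOAWitness R A B ((I [ w₄ ↦ a ]) w₂) ((I [ w₄ ↦ a ]) w₃) ((I [ w₄ ↦ a ]) w₄)
        witness-for-new = witness-resp {R = R} (unmoved m₂) (unmoved m₃) (sym (↦-same I w₄ a)) wit
    in added (witness-for-new ∷ good-fresh M fr anch g) (transfer-fresh M fr)
             (↦-target R□ I (fresh-apart fr m₂ (inj₁ refl)) w₁a ∷ []) hs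

  -- (sub=): an interpretation identifying w and u cannot tell x from x[u/w].
  module _ (I : Label → W) {w u : Label} (w=u : I w ≡ I u) where

    relabel-invisible : ∀ x → I (relabel w u x) ≡ I x
    relabel-invisible x with x ≡ᵇ w in x≟w
    ... | true  = trans (sym w=u) (cong I (sym (ℕ.≡ᵇ⇒≡ x w (subst T (sym x≟w) tt))))
    ... | false = refl

    substE-hyp : ∀ e → Hyp M I e → Hyp M I (substE w u e)
    substE-hyp (x ∶ φ)        _ = tt
    substE-hyp (at (r□ x y))  h = subst₂ R□ (sym (relabel-invisible x)) (sym (relabel-invisible y)) h
    substE-hyp (at (rX x y))  h = subst₂ RX (sym (relabel-invisible x)) (sym (relabel-invisible y)) h
    substE-hyp (at (r A x y)) h = subst₂ (R A) (sym (relabel-invisible x)) (sym (relabel-invisible y)) h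
    substE-hyp (at (x ≐ y))   h = trans (relabel-invisible x) (trans h (sym (relabel-invisible y)))

    substE-concl : ∀ e → Concl M I (substE w u e) → Concl M I e
    substE-concl (x ∶ φ)        c = subst (λ a → _⊨_ M a φ) (relabel-invisible x) c
    substE-concl (at (r□ _ _))  ()
    substE-concl (at (rX _ _))  ()
    substE-concl (at (r _ _ _)) ()
    substE-concl (at (_ ≐ _))   ()

  subst-semantics : ∀ {E : List (IOAInst n)} {w u Γ} (Δ : Sequent n) → ∀ I → Good M I E →
                    All (Hyp M I) (at (w ≐ u) ∷ Δ ++ Γ) →
                    Reduction E M I (at (w ≐ u) ∷ Δ ++ Γ) (at (w ≐ u) ∷ Δ ++ map (substE w u) Δ ++ Γ)
  subst-semantics {w = w} {u} {Γ} Δ I g (w=u ∷ hs) =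
    let hΔ , hΓ = AllP.++⁻ Δ hs in
    reduction M I g (w=u ∷ AllP.++⁺ hΔ (AllP.++⁺ (AllP.map⁺ (All.map (λ {e} → substE-hyp I w=u e) hΔ)) hΓ)) back
    where
    back : Any (Concl M I) (at (w ≐ u) ∷ Δ ++ map (substE w u) Δ ++ Γ) →
           Any (Concl M I) (at (w ≐ u) ∷ Δ ++ Γ)
    back (there c) with AnyP.++⁻ Δ c
    ... | inj₁ cΔ = there (AnyP.++⁺ˡ cΔ)
    ... | inj₂ c' with AnyP.++⁻ (map (substE w u) Δ) c'
    ...   | inj₁ cΔ[u/w] = there (AnyP.++⁺ˡ (Any.map (λ {e} → substE-concl I w=u e) (AnyP.map⁻ cΔ[u/w])))
    ...   | inj₂ cΓ      = there (AnyP.++⁺ʳ Δ cΓ)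

relation-reduces : ∀ {n} {E : List (IOAInst n)} {P Q F Γ} → RelRule E P Q F →
                   All (λ a → at a ∈ Γ) P → AllFresh F Γ → Reduces E Γ E (ats Q ++ Γ)
relation-reduces {Q = Q} rule P∈Γ fr anch =
  anchored-mono (∈-++⁺ʳ (ats Q)) anch , λ M → RuleSemantics.rule-semantics M rule P∈Γ fr anch

ioa-reduces : ∀ {n} {E : List (IOAInst n)} {Γ A B} (disj : Empty (A ∩ B)) {w₁ w₂ w₃ w₄} →
              Fresh w₄ Γ → at (r□ w₁ w₂) ∈ Γ → at (r□ w₁ w₃) ∈ Γ →
              Reduces E Γ (ioa A B disj w₁ w₂ w₃ w₄ ∷ E) (at (r□ w₁ w₄) ∷ Γ)
ioa-reduces disj fr m₂ m₃ anch =
  (there m₂ , there m₃ , here refl) ∷ anchored-mono there anch ,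
  λ M → RuleSemantics.ioa-semantics M disj fr m₂ m₃ anch

subst-reduces : ∀ {n} {E : List (IOAInst n)} {w u Γ} (Δ : Sequent n) →
                Reduces E (at (w ≐ u) ∷ Δ ++ Γ) E (at (w ≐ u) ∷ Δ ++ map (substE w u) Δ ++ Γ)
subst-reduces {w = w} {u} {Γ} Δ anch =
  anchored-mono (⊆.∷⁺ʳ _ (⊆.++⁺ʳ Δ (⊆.xs⊆ys++xs Γ (map (substE w u) Δ)))) anch ,
  λ M → RuleSemantics.subst-semantics M Δ

∨-reduces : ∀ {n} {E : List (IOAInst n)} {Γ w φ ψ} →
            Reduces E ((w ∶ φ ∨ ψ) ∷ Γ) E ((w ∶ φ) ∷ (w ∶ ψ) ∷ Γ)
∨-reduces {Γ = Γ} {w} {φ} {ψ} anch =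
  anchored-mono (there ∘ there ∘ formula-free) anch ,
  λ { M I g (_ ∷ hs) → reduction M I g (tt ∷ tt ∷ hs) back }
  where
  back : ∀ {M I} → Any (Concl M I) ((w ∶ φ) ∷ (w ∶ ψ) ∷ Γ) → Any (Concl M I) ((w ∶ φ ∨ ψ) ∷ Γ)
  back (here t)          = here (inj₁ t)
  back (there (here t))  = here (inj₂ t)
  back (there (there c)) = there c

-- The three normal modalities of the language: a box, its dual diamond and the
-- accessibility atom of the rules (paper: the triples (♡, ♠, R)).
data Modality (n : ℕ) : Set where
  settled : Modality n
  agency  : Subset n → Modality n
  next    : Modality n

box dia : ∀ {n} → Modality n → Fm n → Fm n
box settled    = □
box (agency A) = [ A ]ˣ
box next       = [X]
dia settled    = ◇
dia (agency A) = ⟨ A ⟩ˣ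
dia next       = ⟨X⟩

acc : ∀ {n} → Modality n → Label → Label → Atom n
acc settled    = r□
acc (agency A) = r A
acc next       = rX

module _ {n : ℕ} (M : Model n) where
  open Model M

  Acc : Modality n → W → W → Set
  Acc settled    = R□
  Acc (agency A) = R A
  Acc next       = RX

  acc-intro : ∀ m {I x y} → Acc m (I x) (I y) → AtomHolds M I (acc m x y)
  acc-intro settled    h = h
  acc-intro (agency A) h = h
  acc-intro next       h = h

  acc-elim : ∀ m {I x y} → AtomHolds M I (acc m x y) → Acc m (I x) (I y)
  acc-elim settled    h = h
  acc-elim (agency A) h = h
  acc-elim next       h = h

  box-intro : ∀ m {a φ} → (∀ b → Acc m a b → _⊨_ M b φ) → _⊨_ M a (box m φ)
  box-intro settled    t = t
  box-intro (agency A) t = t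
  box-intro next       t = t

  dia-intro : ∀ m {a b φ} → Acc m a b → _⊨_ M b φ → _⊨_ M a (dia m φ)
  dia-intro settled    h t = _ , h , t
  dia-intro (agency A) h t = _ , h , t
  dia-intro next       h t = _ , h , t

dia-reduces : ∀ {n} m {E : List (IOAInst n)} {Γ w u φ} →
              Reduces E (at (acc m w u) ∷ (w ∶ dia m φ) ∷ Γ)
                      E (at (acc m w u) ∷ (w ∶ dia m φ) ∷ (u ∶ φ) ∷ Γ)
dia-reduces m {Γ = Γ} {w} {u} {φ} anch =
  anchored-mono (⊆.∷⁺ʳ _ (⊆.∷⁺ʳ _ (⊆.xs⊆x∷xs Γ _))) anch ,
  λ { M I g (wu ∷ _ ∷ hs) → reduction M I g (wu ∷ tt ∷ tt ∷ hs) (back M I wu) }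
  where
  back : ∀ M I → AtomHolds M I (acc m w u) →
         Any (Concl M I) (at (acc m w u) ∷ (w ∶ dia m φ) ∷ (u ∶ φ) ∷ Γ) →
         Any (Concl M I) (at (acc m w u) ∷ (w ∶ dia m φ) ∷ Γ)
  back M I wu (there (here t))          = there (here t)
  back M I wu (there (there (here t)))  = there (here (dia-intro M m (acc-elim M m wu) t))
  back M I wu (there (there (there c))) = there (there c)

perm-sound : ∀ {n} {E : List (IOAInst n)} {Γ Δ} → Γ ↭ Δ → Sound E Γ → Sound E Δ
perm-sound Γ↭Δ premise anch M I g hs =
  Any-resp-↭ Γ↭Δ (premise (anchored-mono (∈-resp-↭ (↭-sym Γ↭Δ)) anch) M I g (All-resp-↭ (↭-sym Γ↭Δ) hs))

∧-sound : ∀ {n} {E : List (IOAInst n)} {Γ w φ ψ} →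
          Sound E ((w ∶ φ) ∷ Γ) → Sound E ((w ∶ ψ) ∷ Γ) → Sound E ((w ∶ φ ∧ ψ) ∷ Γ)
∧-sound left right anch M I g (_ ∷ hs)
  with left (anchored-mono (there ∘ formula-free) anch) M I g (tt ∷ hs)
     | right (anchored-mono (there ∘ formula-free) anch) M I g (tt ∷ hs)
... | here t  | here t' = here (t , t')
... | there c | _       = there c
... | here _  | there c = there c

-- The rules whose soundness needs a case distinction on truth.
module Classical (em : ExcludedMiddle 0ℓ) where

  id-sound : ∀ {n} {E : List (IOAInst n)} {Γ} w p → Sound E ((w ∶ var p) ∷ (w ∶ nvar p) ∷ Γ)
  id-sound w p _ M I _ _ with em {Model.V M p (I w)}
  ... | yes p-true  = here p-true
  ... | no  p-false = there (here p-false)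

  -- (□), ([A]ˣ), ([X]): unless some conclusion of Γ is already true, the premise read
  -- with the fresh v sent to an arbitrary accessible point d forces φ at d.
  box-sound : ∀ {n} m {E : List (IOAInst n)} {Γ w v φ} → Fresh v ((w ∶ box m φ) ∷ Γ) →
              Sound E (at (acc m w v) ∷ (v ∶ φ) ∷ Γ) → Sound E ((w ∶ box m φ) ∷ Γ)
  box-sound m {Γ = Γ} {w} {v} {φ} fr@(v≢w ∷ v∉Γ) premise anch M I g (_ ∷ hs)
    with em {Any (Concl M I) Γ}
  ... | yes c = there c
  ... | no ¬c = here (box-intro M m forced)
    where
    forced : ∀ d → Acc M m (I w) d → _⊨_ M d φ
    forced d wd
      with premise (anchored-mono (there ∘ there ∘ formula-free) anch) M (I [ v ↦ d ])
             (good-fresh M fr anch g)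
             (acc-intro M m (↦-target (Acc M m) I v≢w wd) ∷ tt ∷ hyps (transfer-fresh M v∉Γ) hs)
    ... | there (here t)  = subst (λ a → _⊨_ M a φ) (↦-same I v d) t
    ... | there (there c) = ⊥-elim (¬c (concl (transfer-fresh M v∉Γ) c))

  sound : ∀ {n} {E : List (IOAInst n)} {Γ} → Der E Γ → Sound E Γ
  sound (perm Γ↭Δ D)   = perm-sound Γ↭Δ (sound D)
  sound (id w p)       = id-sound w p
  sound (∧-R D D')     = ∧-sound (sound D) (sound D')
  sound (∨-R D)        = reduce ∨-reduces (sound D)
  sound (□-R _ fr D)   = box-sound settled fr (sound D)
  sound ([A]-R _ fr D) = box-sound (agency _) fr (sound D)
  sound ([X]-R _ fr D) = box-sound next fr (sound D)
  sound (◇-R D)        = reduce (dia-reduces settled) (sound D)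
  sound (⟨A⟩-R D)      = reduce (dia-reduces (agency _)) (sound D)
  sound (⟨X⟩-R D)      = reduce (dia-reduces next) (sound D)
  sound (sub= _ _ Δ _ D) = reduce (subst-reduces Δ) (sound D)
  sound (rel rule fr D)  = reduce (relation-reduces rule (All.tabulate (atom-in ⊆.⊆-refl)) fr) (sound D)
  sound (relC {P = P} {Q} rule fr D) =
    reduce (contracted P Q (relation-reduces rule (All.tabulate (atom-in ⊆-nub)) fr)) (sound D)
  sound (IOA-E disj _ _ _ _ fr D) =
    reduce (ioa-reduces disj fr (here refl) (there (here refl))) (sound D)
  sound (IOA-EC disj w₁ w₂ w₃ w₄ fr D) =
    reduce (contracted boxed [ r□ w₁ w₄ ]
              (ioa-reduces disj fr (atom-in {L = boxed} ⊆-nub (here refl))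
                                   (atom-in {L = boxed} ⊆-nub (there (here refl)))))
           (sound D)
    where
    boxed : List (Atom _)
    boxed = r□ w₁ w₂ ∷ r□ w₁ w₃ ∷ []

theorem10 : ExcludedMiddle 0ℓ → ∀ {n} {Γ : Sequent n} → Derivable Γ → Valid Γ
theorem10 em D M I = Classical.sound em D [] M I []
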